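{- Let $F\in\{S_{2,2,1},S_{3,1,1}\}$ and let $G$ be a $\{F,C_5,K_3\}$-free graph. Then $G$ is $C_5$-colorable.
   Context: All graphs are finite and simple. A $C_5$-coloring of $G$ is a map $c: V(G)\to V(C_5)$ with $c(u)c(v)\in E(C_5)$ for every edge $uv\in E(G)$, where $C_5$ is the 5-vertex cycle; $K_3$ is the triangle. For integers $a,b,c\ge 1$, $S_{a,b,c}$ is the graph obtained from the paths $P_{a+1},P_{b+1},P_{c+1}$ ($P_t$ the path on $t$ vertices) by identifying one endvertex of each of them into a single vertex. A graph is $\mathcal F$-free if it contains no member of $\mathcal F$ as an induced subgraph. -}

module Defs where

open import Data.Nat using (ℕ; zero; suc; _+_; _≡ᵇ_; _<ᵇ_)
open import Data.Fin using (Fin; toℕ)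
open import Data.Bool using (Bool; true; false; _∧_; _∨_; not; T)
open import Data.Product using (Σ; _×_; _,_)
open import Relation.Binary.PropositionalEquality using (_≡_)
open import Relation.Nullary using (¬_)
open import Function.Definitions using (Injective)

record Graph (n : ℕ) : Set where
  field
    adj   : Fin n → Fin n → Bool
    sym   : ∀ u v → adj u v ≡ adj v u
    irrefl : ∀ v → adj v v ≡ false
open Graph public

InducedSub : ∀ {k n} → Graph k → Graph n → Set
InducedSub {k} {n} H G =
  Σ (Fin k → Fin n) λ f →
    Injective _≡_ _≡_ f × (∀ u v → adj G (f u) (f v) ≡ adj H u v)

Free : ∀ {k n} → Graph k → Graph n → Set
Free H G = ¬ InducedSub H G

symEdge : (ℕ → ℕ → Bool) → ℕ → ℕ → Bool
symEdge e i j = ((i <ᵇ j) ∧ e i j) ∨ ((j <ᵇ i) ∧ e j i)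

c5e : ℕ → ℕ → Bool
c5e i j = (j ≡ᵇ suc i) ∨ ((i ≡ᵇ 0) ∧ (j ≡ᵇ 4))

k3e : ℕ → ℕ → Bool
k3e i j = true

-- S_{a,b,c} on Fin (1 + a + b + c): vertex 0 is the centre; vertices
-- 1..a form the first arm (path 0-1-...-a), a+1..a+b the second arm
-- (0-(a+1)-...-(a+b)), a+b+1..a+b+c the third arm.
se : ℕ → ℕ → ℕ → ℕ → ℕ → Bool
se a b c i j =
  ((j ≡ᵇ suc i) ∧ not (j ≡ᵇ suc a) ∧ not (j ≡ᵇ suc (a + b)))
  ∨ ((i ≡ᵇ 0) ∧ ((j ≡ᵇ suc a) ∨ (j ≡ᵇ suc (a + b))))

<ᵇ-irr : ∀ i → (i <ᵇ i) ≡ false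
<ᵇ-irr zero = Relation.Binary.PropositionalEquality.refl
<ᵇ-irr (suc i) = <ᵇ-irr i

∨-comm : ∀ x y → (x ∨ y) ≡ (y ∨ x)
∨-comm false false = Relation.Binary.PropositionalEquality.refl
∨-comm false true = Relation.Binary.PropositionalEquality.refl
∨-comm true false = Relation.Binary.PropositionalEquality.refl
∨-comm true true = Relation.Binary.PropositionalEquality.refl

irr : ∀ e i → symEdge e i i ≡ false
irr e i rewrite <ᵇ-irr i = Relation.Binary.PropositionalEquality.refl

fromEdges : ∀ n → (ℕ → ℕ → Bool) → Graph n
fromEdges n e = record
  { adj = λ u v → symEdge e (toℕ u) (toℕ v)
  ; sym = λ u v → ∨-comm ((toℕ u <ᵇ toℕ v) ∧ e (toℕ u) (toℕ v)) ((toℕ v <ᵇ toℕ u) ∧ e (toℕ v) (toℕ u))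
  ; irrefl = λ v → irr e (toℕ v) }

C5 : Graph 5
C5 = fromEdges 5 c5e

K3 : Graph 3
K3 = fromEdges 3 k3e

S : (a b c : ℕ) → Graph (suc (a + b + c))
S a b c = fromEdges _ (se a b c)

C5Colorable : ∀ {n} → Graph n → Set
C5Colorable {n} G =
  Σ (Fin n → Fin 5) λ col → ∀ u v → T (adj G u v) → T (adj C5 (col u) (col v))

{-# OPTIONS --safe #-}

-- G is coloured one closed set of vertices at a time, working in the subgraph induced by the
-- vertices not yet coloured.  A search from any vertex either 2-colours its component or finds
-- an odd closed walk; a shortest one runs around an induced odd cycle c₀ … c_{L-1}, and
-- L ∉ {1, 3, 5} since G is loopless, K₃-free and C₅-free.  For L ≥ 7, a path of six cycle
-- vertices, a vertex z seeing two of them at distance two and a neighbour of z missing the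
-- path would span an induced S₂,₂,₁ and S₃,₁,₁.  Hence every vertex seeing the cycle sees some
-- pair c_q, c_{q+2}, the set X of such vertices is closed under adjacency, and adjacent
-- vertices of X see pairs at consecutive positions.  Mapping C_L onto C₅ and giving a vertex
-- that sees c_q and c_{q+2} the colour of position q therefore colours X.
module Submission where

open import Defs
open import Data.Bool using (Bool; true; false; T; _∧_)
open import Data.Bool.Properties using (∧-comm; ∧-zeroʳ; T?; T-≡) renaming (_≟_ to _≟ᵇ_)
open import Data.Empty using (⊥; ⊥-elim)
open import Data.Fin using (Fin; zero; suc; toℕ; fromℕ<; #_)
open import Data.Fin.Properties using (all?; any?; toℕ<n; toℕ-fromℕ<) renaming (_≟_ to _≟ᶠ_)
open import Data.Fin.Subset using (Subset; _∈_; _∉_; _⊂_; _⊃_; _∪_; _∩_; _─_; ⁅_⁆; Nonempty)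
  renaming (⊤ to all-vertices)
open import Data.Fin.Subset.Induction using (⊂-wellFounded; ⊃-wellFounded)
open import Data.Fin.Subset.Properties
  using (_∈?_; nonempty?; ∈⊤; x∈⁅x⁆; x∈⁅y⁆⇒x≡y; p⊆p∪q; q⊆p∪q; x∈p∪q⁻; x∈p∩q⁺; x∈p∧x∉q⇒x∈p─q; p∩q≢∅⇒p─q⊂p)
open import Data.Nat using (ℕ; zero; suc; _+_; _*_; _∸_; _≤_; _<_; z≤n; s≤s; parity; NonZero; _<?_; _≟_)
open import Data.Nat.DivMod
  using (_%_; _/_; m≡m%n+[m/n]*n; [m+kn]%n≡m%n; [m+n]%n≡m%n; m<n⇒m%n≡m; n%n≡0; m%n<n)
open import Data.Nat.Induction using (<-wellFounded)
open import Data.Nat.Properties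
  using ( _≤?_; anyUpTo?; +-commutativeSemigroup; +-comm; +-suc; +-assoc; +-identityʳ; suc-injective
        ; ≤-refl; ≤-trans; ≤-antisym; ≤-pred; <⇒≤; ≮⇒≥; ≰⇒≥; m≤m+n; n≤0⇒n≡0; m≤n⇒m<n∨m≡n; m+n≮n
        ; +-cancelˡ-≤; +-cancelʳ-≤; m∸n+n≡m; m+[n∸m]≡n; m≤n⇒m∸n≡0; +-∸-assoc; m<n+o⇒m∸n<o; m+n∸n≡m; 0∸n≡0 )
open import Data.Parity.Base as ℙ using (Parity; 0ℙ; 1ℙ; _⁻¹)
open import Data.Parity.Properties using (+-homo-+; suc-homo-⁻¹; ⁻¹-selfInverse; p+p⁻¹≡1ℙ)
  renaming (_≟_ to _≟ᵖ_)
open import Induction.WellFounded using (Acc; acc)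
open import Algebra.Properties.CommutativeSemigroup +-commutativeSemigroup using (x∙yz≈y∙xz)
open import Data.Product using (Σ; ∃; ∃₂; _×_; _,_; proj₁; proj₂)
open import Data.Product.Properties using (≡-dec)
open import Data.Sum as Sum using (_⊎_; inj₁; inj₂; [_,_])
open import Data.Unit using (⊤; tt)
open import Data.Vec using (allFin; lookup; tabulate; _∷_; [])
open import Data.Vec.Properties using ([]=⇒lookup; lookup⇒[]=; lookup∘tabulate)
open import Data.Vec.Relation.Unary.All using (All; _∷_; [])
open import Data.Vec.Relation.Unary.All.Properties using (tabulate⁻)
open import Function using (_∘_)
open import Function.Bundles using (Equivalence)
open import Relation.Binary.PropositionalEquality
  using (_≡_; _≢_; refl; trans; cong; cong₂; subst; subst₂; module ≡-Reasoning) renaming (sym to ≡-sym)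
open import Relation.Nullary using (Dec; yes; no; does; ¬_; ¬?; contradiction)
open import Relation.Nullary.Decidable
  using (True; False; toWitness; toWitnessFalse; dec-true; _×-dec_; _→-dec_; _⊎-dec_)

private
  variable
    k l n : ℕ

parity-suc : ∀ k → parity (suc k) ≡ parity k ⁻¹
parity-suc k = ≡-sym (⁻¹-selfInverse (suc-homo-⁻¹ k))

m≤n⇒∃[o]o+m≡n : ∀ {m n} → m ≤ n → ∃ λ o → o + m ≡ n
m≤n⇒∃[o]o+m≡n m≤n = _ , m∸n+n≡m m≤n

[1+m]%n≡[1+m%n]%n : ∀ m n .{{_ : NonZero n}} → suc m % n ≡ suc (m % n) % n
[1+m]%n≡[1+m%n]%n m n = begin
  suc m % n                         ≡⟨ cong (λ x → suc x % n) (m≡m%n+[m/n]*n m n) ⟩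
  (suc (m % n) + (m / n) * n) % n   ≡⟨ [m+kn]%n≡m%n (suc (m % n)) (m / n) n ⟩
  suc (m % n) % n                   ∎
  where open ≡-Reasoning

least-satisfying : {P : ℕ → Set} → (∀ m → Dec (P m)) → ∀ {m} → P m →
                   ∃ λ k → P k × (∀ {j} → j < k → ¬ P j)
least-satisfying {P = P} P? {m} = go m (<-wellFounded m)
  where
  go : ∀ m → Acc _<_ m → P m → ∃ λ k → P k × (∀ {j} → j < k → ¬ P j)
  go m (acc smaller) pm with anyUpTo? P? m
  ... | no none            = m , pm , λ j<m pj → none (_ , j<m , pj)
  ... | yes (j , j<m , pj) = go j (smaller j<m) pj

p+q≡0ℙ⇒p≡q : ∀ p q → p ℙ.+ q ≡ 0ℙ → p ≡ q
p+q≡0ℙ⇒p≡q 0ℙ 0ℙ _ = refl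
p+q≡0ℙ⇒p≡q 1ℙ 1ℙ _ = refl

parity-+-suc : ∀ k l → parity k ≡ parity l → parity (k + suc l) ≡ 1ℙ
parity-+-suc k l same = begin
  parity (k + suc l)              ≡⟨ +-homo-+ k (suc l) ⟩
  parity k ℙ.+ parity (suc l)     ≡⟨ cong₂ ℙ._+_ same (parity-suc l) ⟩
  parity l ℙ.+ parity l ⁻¹        ≡⟨ p+p⁻¹≡1ℙ (parity l) ⟩
  1ℙ                              ∎
  where open ≡-Reasoning

Adj : Graph n → Fin n → Fin n → Set
Adj G u v = T (adj G u v)

Adj-sym : (G : Graph n) {u v : Fin n} → Adj G u v → Adj G v u
Adj-sym G {u} {v} = subst T (sym G u v)

Adj-irrefl : (G : Graph n) {v : Fin n} → ¬ Adj G v v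
Adj-irrefl G {v} = subst T (irrefl G v)

T⇒≡true : ∀ {b} → T b → b ≡ true
T⇒≡true = Equivalence.to T-≡

¬T⇒≡false : ∀ {b} → ¬ T b → b ≡ false
¬T⇒≡false {false} _  = refl
¬T⇒≡false {true}  ¬t = ⊥-elim (¬t tt)

-- Recognising induced subgraphs

AgreeAbove : (g h : Fin k → Fin k → Bool) → Set
AgreeAbove {zero}  g h = ⊤
AgreeAbove {suc k} g h =
  All (λ j → g zero (suc j) ≡ h zero (suc j)) (allFin k) ×
  AgreeAbove (λ i j → g (suc i) (suc j)) (λ i j → h (suc i) (suc j))

agreeAbove⇒≡ : {g h : Fin k → Fin k → Bool} →
               (∀ u v → g u v ≡ g v u) → (∀ u v → h u v ≡ h v u) → (∀ v → g v v ≡ h v v) →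
               AgreeAbove g h → ∀ u v → g u v ≡ h u v
agreeAbove⇒≡ g-sym h-sym diag _           zero    zero    = diag zero
agreeAbove⇒≡ g-sym h-sym diag (row , _)   zero    (suc j) = tabulate⁻ row j
agreeAbove⇒≡ g-sym h-sym diag (row , _)   (suc i) zero    =
  trans (g-sym _ _) (trans (tabulate⁻ row i) (h-sym _ _))
agreeAbove⇒≡ g-sym h-sym diag (_ , rest) (suc i) (suc j) =
  agreeAbove⇒≡ (λ u v → g-sym (suc u) (suc v)) (λ u v → h-sym (suc u) (suc v)) (diag ∘ suc) rest i j

Twins : Graph k → Fin k → Fin k → Set
Twins H u v = u ≢ v × adj H u v ≡ false × (∀ w → adj H u w ≡ adj H v w)

twins? : (H : Graph k) → ∀ u v → Dec (Twins H u v)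
twins? H u v = ¬? (u ≟ᶠ v) ×-dec (adj H u v ≟ᵇ false) ×-dec all? (λ w → adj H u w ≟ᵇ adj H v w)

TwinFree : Graph k → Set
TwinFree H = ∀ u v → ¬ Twins H u v

twinFree? : (H : Graph k) → Dec (TwinFree H)
twinFree? H = all? λ u → all? λ v → ¬? (twins? H u v)

-- A map respecting adjacency and non-adjacency can only identify twins.
induced-embedding : (G : Graph n) (H : Graph k) (f : Fin k → Fin n) →
                    AgreeAbove (λ u v → adj G (f u) (f v)) (adj H) →
                    (∀ {u v} → Twins H u v → f u ≢ f v) → InducedSub H G
induced-embedding G H f table separated = f , injective , agree
  where
  agree : ∀ u v → adj G (f u) (f v) ≡ adj H u v
  agree = agreeAbove⇒≡ (λ u v → sym G (f u) (f v)) (sym H)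
                       (λ v → trans (irrefl G (f v)) (≡-sym (irrefl H v))) table
  injective : ∀ {u v} → f u ≡ f v → u ≡ v
  injective {u} {v} fu≡fv with u ≟ᶠ v
  ... | yes u≡v = u≡v
  ... | no u≢v = ⊥-elim (separated (u≢v , nonadjacent , same-neighbours) fu≡fv)
    where
    nonadjacent : adj H u v ≡ false
    nonadjacent = trans (≡-sym (agree u v)) (trans (cong (adj G (f u)) (≡-sym fu≡fv)) (irrefl G (f u)))
    same-neighbours : ∀ w → adj H u w ≡ adj H v w
    same-neighbours w = trans (≡-sym (agree u w)) (trans (cong (λ x → adj G x (f w)) fu≡fv) (agree v w))

NoIsolated : Graph k → Set
NoIsolated H = ∀ u → ∃ λ v → Adj H u v

noIsolated? : (H : Graph k) → Dec (NoIsolated H)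
noIsolated? H = all? λ u → any? λ v → T? (adj H u v)

twinFree-K3 : TwinFree K3
twinFree-K3 = toWitness {a? = twinFree? K3} tt

twinFree-C5 : TwinFree C5
twinFree-C5 = toWitness {a? = twinFree? C5} tt

twinFree-S221 : TwinFree (S 2 2 1)
twinFree-S221 = toWitness {a? = twinFree? (S 2 2 1)} tt

-- The two legs of length one are the only twins of S₃,₁,₁.
twins-S311 : ∀ u v → Twins (S 3 1 1) u v → (u , v) ≡ (# 4 , # 5) ⊎ (u , v) ≡ (# 5 , # 4)
twins-S311 = toWitness {a? = all? λ u → all? λ v → twins? (S 3 1 1) u v →-dec (legs? u v)} tt
  where
  legs? : ∀ u v → Dec ((u , v) ≡ (# 4 , # 5) ⊎ (u , v) ≡ (# 5 , # 4))
  legs? u v = ≡-dec _≟ᶠ_ _≟ᶠ_ (u , v) (# 4 , # 5) ⊎-dec ≡-dec _≟ᶠ_ _≟ᶠ_ (u , v) (# 5 , # 4)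

noIsolated-K3 : NoIsolated K3
noIsolated-K3 = toWitness {a? = noIsolated? K3} tt

noIsolated-C5 : NoIsolated C5
noIsolated-C5 = toWitness {a? = noIsolated? C5} tt

noIsolated-S221 : NoIsolated (S 2 2 1)
noIsolated-S221 = toWitness {a? = noIsolated? (S 2 2 1)} tt

noIsolated-S311 : NoIsolated (S 3 1 1)
noIsolated-S311 = toWitness {a? = noIsolated? (S 3 1 1)} tt

-- Induced subgraphs

_[_] : Graph n → Subset n → Graph n
G [ U ] = record
  { adj    = λ u v → (lookup U u ∧ lookup U v) ∧ adj G u v
  ; sym    = λ u v → cong₂ _∧_ (∧-comm (lookup U u) (lookup U v)) (sym G u v)
  ; irrefl = λ v → trans (cong ((lookup U v ∧ lookup U v) ∧_) (irrefl G v)) (∧-zeroʳ _)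
  }

module _ {P : Fin n → Set} (P? : ∀ v → Dec (P v)) where

  subset : Subset n
  subset = tabulate (does ∘ P?)

  ∈-subset⁺ : ∀ {v} → P v → v ∈ subset
  ∈-subset⁺ {v} p = lookup⇒[]= v subset (trans (lookup∘tabulate _ v) (dec-true (P? v) p))

  ∈-subset⁻ : ∀ {v} → v ∈ subset → P v
  ∈-subset⁻ {v} v∈ with P? v | trans (≡-sym (lookup∘tabulate _ v)) ([]=⇒lookup v∈)
  ... | yes p | _  = p
  ... | no _  | ()

module _ (G : Graph n) (U : Subset n) where

  adj-[]-inside : ∀ {u v} → u ∈ U → v ∈ U → adj (G [ U ]) u v ≡ adj G u v
  adj-[]-inside u∈U v∈U rewrite []=⇒lookup u∈U | []=⇒lookup v∈U = refl

  Adj-[]⁺ : ∀ {u v} → u ∈ U → v ∈ U → Adj G u v → Adj (G [ U ]) u v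
  Adj-[]⁺ u∈U v∈U = subst T (≡-sym (adj-[]-inside u∈U v∈U))

  Adj-[]⁻ : ∀ {u v} → Adj (G [ U ]) u v → u ∈ U × v ∈ U × Adj G u v
  Adj-[]⁻ {u} {v} a with lookup U u in eu | lookup U v in ev
  Adj-[]⁻ {u} {v} a | true  | true  = lookup⇒[]= u U eu , lookup⇒[]= v U ev , a
  Adj-[]⁻ ()        | true  | false
  Adj-[]⁻ ()        | false | _

  embedding-from-[] : (H : Graph k) → NoIsolated H → InducedSub H (G [ U ]) → InducedSub H G
  embedding-from-[] H no-isolated (f , f-injective , agree) = f , f-injective , agree′
    where
    inside : ∀ u → f u ∈ U
    inside u with no-isolated u
    ... | w , a = proj₁ (Adj-[]⁻ (subst T (≡-sym (agree u w)) a))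
    agree′ : ∀ u v → adj G (f u) (f v) ≡ adj H u v
    agree′ u v = trans (≡-sym (adj-[]-inside (inside u) (inside v))) (agree u v)

  Free-[] : (H : Graph k) → NoIsolated H → Free H G → Free H (G [ U ])
  Free-[] H no-isolated free embedding = free (embedding-from-[] H no-isolated embedding)

-- Walks, components and bipartitions

infixr 5 _∷_

data Walk (G : Graph n) : Fin n → Fin n → ℕ → Set where
  []  : ∀ {x} → Walk G x x 0
  _∷_ : ∀ {x y z k} → Adj G x y → Walk G y z k → Walk G x z (suc k)

Reachable : Graph n → Fin n → Fin n → Set
Reachable G r v = ∃ (Walk G r v)

OddClosedWalk : Graph n → Set
OddClosedWalk G = ∃₂ λ x ℓ → Walk G x x ℓ × parity ℓ ≡ 1ℙ

Closed : Graph n → Subset n → Set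
Closed G X = ∀ {u v} → u ∈ X → Adj G u v → v ∈ X

Homomorphism : Graph n → Graph k → Set
Homomorphism {n} {k} G H = Σ (Fin n → Fin k) λ f → ∀ u v → Adj G u v → Adj H (f u) (f v)

module _ {G : Graph n} where

  infixr 5 _++_
  infixl 5 _∷ʳ_

  _++_ : ∀ {x y z} → Walk G x y k → Walk G y z l → Walk G x z (k + l)
  []      ++ q = q
  (a ∷ p) ++ q = a ∷ (p ++ q)

  _∷ʳ_ : ∀ {x y z} → Walk G x y k → Adj G y z → Walk G x z (suc k)
  []      ∷ʳ b = b ∷ []
  (a ∷ p) ∷ʳ b = a ∷ (p ∷ʳ b)

  reverse : ∀ {x y} → Walk G x y k → Walk G y x k
  reverse []      = []
  reverse (a ∷ p) = reverse p ∷ʳ Adj-sym G a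

  walk? : ∀ x y k → Dec (Walk G x y k)
  walk? x y zero with x ≟ᶠ y
  ... | yes refl = yes []
  ... | no x≢y   = no λ { [] → x≢y refl }
  walk? x y (suc k) with any? (λ z → T? (adj G x z) ×-dec walk? z y k)
  ... | yes (z , a , p) = yes (a ∷ p)
  ... | no none         = no λ { (a ∷ p) → none (_ , a , p) }

  component : (r : Fin n) → ∃ λ R → r ∈ R × Closed G R × (∀ {v} → v ∈ R → Reachable G r v)
  component r = grow ⁅ r ⁆ (⊃-wellFounded ⁅ r ⁆) (x∈⁅x⁆ r) from-r
    where
    from-r : ∀ {v} → v ∈ ⁅ r ⁆ → Reachable G r v
    from-r v∈⁅r⁆ with x∈⁅y⁆⇒x≡y r v∈⁅r⁆
    ... | refl = 0 , []

    Frontier : Subset n → Set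
    Frontier R = ∃₂ λ u v → u ∈ R × v ∉ R × Adj G u v

    frontier? : ∀ R → Dec (Frontier R)
    frontier? R = any? λ u → any? λ v → u ∈? R ×-dec ¬? (v ∈? R) ×-dec T? (adj G u v)

    grow : ∀ R → Acc _⊃_ R → r ∈ R → (∀ {v} → v ∈ R → Reachable G r v) →
           ∃ λ R → r ∈ R × Closed G R × (∀ {v} → v ∈ R → Reachable G r v)
    grow R (acc larger) r∈R reach with frontier? R
    ... | no no-frontier = R , r∈R , closed , reach
      where
      closed : Closed G R
      closed {u} {v} u∈R a with v ∈? R
      ... | yes v∈R = v∈R
      ... | no v∉R  = ⊥-elim (no-frontier (u , v , u∈R , v∉R , a))
    ... | yes (u , v , u∈R , v∉R , a) =
      grow (R ∪ ⁅ v ⁆) (larger R⊂R∪v) (p⊆p∪q ⁅ v ⁆ r∈R) reach′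
      where
      R⊂R∪v : R ⊂ R ∪ ⁅ v ⁆
      R⊂R∪v = p⊆p∪q ⁅ v ⁆ , v , q⊆p∪q R ⁅ v ⁆ (x∈⁅x⁆ v) , v∉R
      reach′ : ∀ {x} → x ∈ R ∪ ⁅ v ⁆ → Reachable G r x
      reach′ x∈ with x∈p∪q⁻ R ⁅ v ⁆ x∈
      ... | inj₁ x∈R = reach x∈R
      ... | inj₂ x∈⁅v⁆ with x∈⁅y⁆⇒x≡y v x∈⁅v⁆ | reach u∈R
      ...   | refl | k , p = suc k , p ∷ʳ a

  two-sided-or-odd : ∀ {r R} → Closed G R → (∀ {v} → v ∈ R → Reachable G r v) →
                     (Σ (Fin n → Parity) λ side → ∀ {u v} → u ∈ R → Adj G u v → side u ≢ side v)
                     ⊎ OddClosedWalk G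
  two-sided-or-odd {r} {R} closed reach = resolve (any? λ u → any? λ v → conflict? u v)
    where
    side : Fin n → Parity
    side v with v ∈? R
    ... | yes v∈R = parity (proj₁ (reach v∈R))
    ... | no _    = 0ℙ

    side-walk : ∀ {v} → v ∈ R → ∃ λ k → Walk G r v k × parity k ≡ side v
    side-walk {v} v∈R with v ∈? R
    ... | yes v∈R′ = proj₁ (reach v∈R′) , proj₂ (reach v∈R′) , refl
    ... | no v∉R   = ⊥-elim (v∉R v∈R)

    Conflict : Fin n → Fin n → Set
    Conflict u v = u ∈ R × Adj G u v × side u ≡ side v

    conflict? : ∀ u v → Dec (Conflict u v)
    conflict? u v = u ∈? R ×-dec T? (adj G u v) ×-dec (side u ≟ᵖ side v)

    resolve : Dec (∃₂ Conflict) →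
              (Σ (Fin n → Parity) λ side → ∀ {u v} → u ∈ R → Adj G u v → side u ≢ side v)
              ⊎ OddClosedWalk G
    resolve (no no-conflict) = inj₁ (side , λ {u} {v} u∈R a same → no-conflict (u , v , u∈R , a , same))
    resolve (yes (u , v , u∈R , a , same)) with side-walk u∈R | side-walk (closed u∈R a)
    ... | k , p , pk | l , q , ql =
      inj₂ (r , k + suc l , p ++ a ∷ reverse q , parity-+-suc k l (trans pk (trans same (≡-sym ql))))

-- Colouring by closed parts

record ColouredPart (G : Graph n) (H : Graph k) (r : Fin n) : Set where
  field
    X          : Subset n
    -- In G [ U ] with r ∈ U this makes X meet U, as all vertices outside U are isolated.
    anchored   : r ∈ X ⊎ ∃₂ λ x y → x ∈ X × Adj G x y
    closed     : Closed G X
    colour     : Fin n → Fin k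
    colour-hom : ∀ {u v} → u ∈ X → Adj G u v → Adj H (colour u) (colour v)

bipartite-part-or-odd : {G : Graph n} (H : Graph k) {a b : Fin k} → Adj H a b →
                        (r : Fin n) → ColouredPart G H r ⊎ OddClosedWalk G
bipartite-part-or-odd {k = k} {G = G} H {a} {b} ab r with component r
... | R , r∈R , closed , reach with two-sided-or-odd closed reach
...   | inj₂ odd = inj₂ odd
...   | inj₁ (side , two-sided) = inj₁ record
  { X = R ; anchored = inj₁ r∈R ; closed = closed
  ; colour = end ∘ side ; colour-hom = λ u∈R uv → end-hom (two-sided u∈R uv) }
  where
  end : Parity → Fin k
  end 0ℙ = a
  end 1ℙ = b
  end-hom : ∀ {p q} → p ≢ q → Adj H (end p) (end q)
  end-hom {0ℙ} {0ℙ} p≢q = ⊥-elim (p≢q refl)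
  end-hom {0ℙ} {1ℙ} _   = ab
  end-hom {1ℙ} {0ℙ} _   = Adj-sym H ab
  end-hom {1ℙ} {1ℙ} p≢q = ⊥-elim (p≢q refl)

homomorphism-from-parts : (G : Graph n) (H : Graph k) → Fin k →
                          (∀ U r → r ∈ U → ColouredPart (G [ U ]) H r) → Homomorphism G H
homomorphism-from-parts {n} {k} G H default part =
  let f , f-hom = on all-vertices (⊂-wellFounded all-vertices)
  in  f , λ u v uv → f-hom u v (Adj-[]⁺ G all-vertices ∈⊤ ∈⊤ uv)
  where
  on : ∀ U → Acc _⊂_ U → Homomorphism (G [ U ]) H
  on U (acc smaller) with nonempty? U
  ... | no empty = (λ _ → default) , λ u v uv → ⊥-elim (empty (u , proj₁ (Adj-[]⁻ G U uv)))
  ... | yes (r , r∈U) = combined , combined-hom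
    where
    open ColouredPart (part U r r∈U)

    meets : Nonempty (U ∩ X)
    meets with anchored
    ... | inj₁ r∈X               = r , x∈p∩q⁺ (r∈U , r∈X)
    ... | inj₂ (x , _ , x∈X , a) = x , x∈p∩q⁺ (proj₁ (Adj-[]⁻ G U a) , x∈X)

    rest : Homomorphism (G [ U ─ X ]) H
    rest = on (U ─ X) (smaller (p∩q≢∅⇒p─q⊂p U X meets))

    combined : Fin n → Fin k
    combined v with v ∈? X
    ... | yes _ = colour v
    ... | no _  = proj₁ rest v

    combined-hom : ∀ u v → Adj (G [ U ]) u v → Adj H (combined u) (combined v)
    combined-hom u v uv with u ∈? X | v ∈? X | Adj-[]⁻ G U uv
    ... | yes u∈X | yes _   | _ = colour-hom u∈X uv
    ... | yes u∈X | no v∉X  | _ = ⊥-elim (v∉X (closed u∈X uv))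
    ... | no u∉X  | yes v∈X | _ = ⊥-elim (u∉X (closed v∈X (Adj-sym (G [ U ]) uv)))
    ... | no u∉X  | no v∉X  | u∈U , v∈U , uv′ =
      proj₂ rest u v (Adj-[]⁺ G (U ─ X) (x∈p∧x∉q⇒x∈p─q u∈U u∉X) (x∈p∧x∉q⇒x∈p─q v∈U v∉X) uv′)

-- Shortest odd cycles

record ShortestOddCycle (G : Graph n) (L : ℕ) : Set where
  field
    vertex   : ℕ → Fin n
    adjacent : ∀ m → Adj G (vertex m) (vertex (suc m))
    periodic : ∀ m → vertex (L + m) ≡ vertex m
    odd      : parity L ≡ 1ℙ
    shortest : ∀ {x ℓ} → Walk G x x ℓ → parity ℓ ≡ 1ℙ → L ≤ ℓ

module _ {G : Graph n} where

  vertexAt : ∀ {x y} → Walk G x y k → ℕ → Fin n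
  vertexAt {x = x} []      _       = x
  vertexAt {x = x} (_ ∷ _) zero    = x
  vertexAt         (_ ∷ p) (suc i) = vertexAt p i

  vertexAt-zero : ∀ {x y} (p : Walk G x y k) → vertexAt p 0 ≡ x
  vertexAt-zero []      = refl
  vertexAt-zero (_ ∷ _) = refl

  vertexAt-length : ∀ {x y} (p : Walk G x y k) → vertexAt p k ≡ y
  vertexAt-length []      = refl
  vertexAt-length (_ ∷ p) = vertexAt-length p

  vertexAt-adjacent : ∀ {x y} (p : Walk G x y k) {i} → i < k → Adj G (vertexAt p i) (vertexAt p (suc i))
  vertexAt-adjacent (a ∷ p) {zero}  _         = subst (Adj G _) (≡-sym (vertexAt-zero p)) a
  vertexAt-adjacent (_ ∷ p) {suc i} (s≤s i<k) = vertexAt-adjacent p i<k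

  module _ {x L′} (w : Walk G x x (suc L′)) where

    private
      L = suc L′

    cyclic : ℕ → Fin n
    cyclic m = vertexAt w (m % L)

    cyclic-periodic : ∀ m → cyclic (L + m) ≡ cyclic m
    cyclic-periodic m = cong (vertexAt w) (trans (cong (_% L) (+-comm L m)) ([m+n]%n≡m%n m L))

    cyclic-adjacent : ∀ m → Adj G (cyclic m) (cyclic (suc m))
    cyclic-adjacent m =
      subst (λ i → Adj G (cyclic m) (vertexAt w i)) (≡-sym ([1+m]%n≡[1+m%n]%n m L))
            (step (m % L) (m%n<n m L))
      where
      step : ∀ i → i < L → Adj G (vertexAt w i) (vertexAt w (suc i % L))
      step i (s≤s i≤L′) with m≤n⇒m<n∨m≡n i≤L′
      ... | inj₁ i<L′ = subst (λ j → Adj G (vertexAt w i) (vertexAt w j)) (≡-sym (m<n⇒m%n≡m (s≤s i<L′)))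
                              (vertexAt-adjacent w (s≤s (<⇒≤ i<L′)))
      ... | inj₂ refl = subst (λ j → Adj G (vertexAt w i) (vertexAt w j)) (≡-sym (n%n≡0 L))
                              (subst (Adj G (vertexAt w i)) closed (vertexAt-adjacent w (s≤s ≤-refl)))
        where
        closed : vertexAt w L ≡ vertexAt w 0
        closed = trans (vertexAt-length w) (≡-sym (vertexAt-zero w))

  oddClosedWalk? : ∀ ℓ → Dec (parity ℓ ≡ 1ℙ × ∃ λ y → Walk G y y ℓ)
  oddClosedWalk? ℓ = (parity ℓ ≟ᵖ 1ℙ) ×-dec any? (λ y → walk? y y ℓ)

  shortest-odd-cycle : OddClosedWalk G → ∃ (ShortestOddCycle G)
  shortest-odd-cycle (x , ℓ , w , odd) with least-satisfying oddClosedWalk? (odd , x , w)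
  ... | zero   , (() , _) , _
  ... | suc L′ , (odd , y , w) , minimal = suc L′ , record
    { vertex   = cyclic w
    ; adjacent = cyclic-adjacent w
    ; periodic = cyclic-periodic w
    ; odd      = odd
    ; shortest = λ {z} {ℓ} p oddℓ → ≮⇒≥ λ ℓ<L → minimal ℓ<L (oddℓ , z , p)
    }

module ShortestOddCycleFacts {G : Graph n} {L : ℕ} (C : ShortestOddCycle G L) where

  open ShortestOddCycle C

  arc : ∀ i d → Walk G (vertex i) (vertex (d + i)) d
  arc i zero    = []
  arc i (suc d) =
    subst (λ j → Walk G (vertex i) (vertex j) (suc d)) (+-suc d i) (adjacent i ∷ arc (suc i) d)

  -- Closing the walk with one of the two arcs of the cycle gives an odd closed walk, which
  -- is at least as long as the cycle.
  detour : ∀ x d {k} → d < L → Walk G (vertex x) (vertex (d + x)) k →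
           (parity (d + k) ≡ 0ℙ × d ≤ k) ⊎ (parity (d + k) ≡ 1ℙ × L ≤ d + k)
  detour x d {k} d<L p with parity (d + k) in parity-d+k
  ... | 1ℙ = inj₂ (refl , shortest (arc x d ++ reverse p) parity-d+k)
  ... | 0ℙ = inj₁ (refl , +-cancelʳ-≤ (L ∸ d) d k d+[L∸d]≤k+[L∸d])
    where
    d+[L∸d]≡L : d + (L ∸ d) ≡ L
    d+[L∸d]≡L = m+[n∸m]≡n (<⇒≤ d<L)
    back : vertex ((L ∸ d) + (d + x)) ≡ vertex x
    back = begin
      vertex ((L ∸ d) + (d + x))   ≡⟨ cong vertex (≡-sym (+-assoc (L ∸ d) d x)) ⟩
      vertex ((L ∸ d) + d + x)     ≡⟨ cong (λ i → vertex (i + x)) (trans (+-comm (L ∸ d) d) d+[L∸d]≡L) ⟩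
      vertex (L + x)               ≡⟨ periodic x ⟩
      vertex x                     ∎
      where open ≡-Reasoning
    around : Walk G (vertex x) (vertex x) (k + (L ∸ d))
    around = p ++ subst (λ y → Walk G (vertex (d + x)) y (L ∸ d)) back (arc (d + x) (L ∸ d))
    parity-d≡parity-k : parity d ≡ parity k
    parity-d≡parity-k = p+q≡0ℙ⇒p≡q (parity d) (parity k) (trans (≡-sym (+-homo-+ d k)) parity-d+k)
    odd-around : parity (k + (L ∸ d)) ≡ 1ℙ
    odd-around = begin
      parity (k + (L ∸ d))          ≡⟨ +-homo-+ k (L ∸ d) ⟩
      parity k ℙ.+ parity (L ∸ d)   ≡⟨ cong (ℙ._+ parity (L ∸ d)) (≡-sym parity-d≡parity-k) ⟩
      parity d ℙ.+ parity (L ∸ d)   ≡⟨ ≡-sym (+-homo-+ d (L ∸ d)) ⟩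
      parity (d + (L ∸ d))          ≡⟨ cong parity d+[L∸d]≡L ⟩
      parity L                      ≡⟨ odd ⟩
      1ℙ                            ∎
      where open ≡-Reasoning
    d+[L∸d]≤k+[L∸d] : d + (L ∸ d) ≤ k + (L ∸ d)
    d+[L∸d]≤k+[L∸d] = subst (_≤ k + (L ∸ d)) (≡-sym d+[L∸d]≡L) (shortest around odd-around)

  no-chord : ∀ x d → d < L → Adj G (vertex x) (vertex (d + x)) → d ≡ 1 ⊎ suc d ≡ L
  no-chord x d d<L a with detour x d d<L (a ∷ [])
  ... | inj₁ (() , z≤n)
  ... | inj₁ (_ , s≤s z≤n) = inj₁ refl
  ... | inj₂ (_ , L≤d+1)   = inj₂ (≤-antisym d<L (subst (L ≤_) (+-comm d 1) L≤d+1))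

  common-neighbour : ∀ x d {v} → d < L → Adj G v (vertex x) → Adj G v (vertex (d + x)) →
                     d ≡ 0 ⊎ d ≡ 2 ⊎ 2 + d ≡ L
  common-neighbour x d d<L a b with detour x d d<L (Adj-sym G a ∷ b ∷ [])
  ... | inj₁ (_ , z≤n)           = inj₁ refl
  ... | inj₁ (() , s≤s z≤n)
  ... | inj₁ (_ , s≤s (s≤s z≤n)) = inj₂ (inj₁ refl)
  ... | inj₂ (odd-d+2 , L≤d+2) with m≤n⇒m<n∨m≡n d<L
  ...   | inj₁ 1+d<L = inj₂ (inj₂ (≤-antisym 1+d<L (subst (L ≤_) (+-comm d 2) L≤d+2)))
  ...   | inj₂ refl  = contradiction (trans (≡-sym even-L) odd) λ ()
    where
    even-L : parity (suc d) ≡ 0ℙ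
    even-L = trans (parity-suc d) (cong _⁻¹ (trans (cong parity (+-comm 2 d)) odd-d+2))

  non-chord : ∀ x d {d<L : True (d <? L)} {far : False (d ≟ 1 ⊎-dec suc d ≟ L)} →
              ¬ Adj G (vertex x) (vertex (d + x))
  non-chord x d {d<L} {far} = toWitnessFalse far ∘ no-chord x d (toWitness d<L)

  non-common : ∀ x d {v} {d<L : True (d <? L)} {far : False (d ≟ 0 ⊎-dec d ≟ 2 ⊎-dec 2 + d ≟ L)} →
               Adj G v (vertex x) → ¬ Adj G v (vertex (d + x))
  non-common x d {d<L = d<L} {far} a = toWitnessFalse far ∘ common-neighbour x d (toWitness d<L) a

module _ {G : Graph n} where

  loop-free : ¬ ShortestOddCycle G 1
  loop-free C = Adj-irrefl G (subst (Adj G (vertex 0)) (periodic 0) (adjacent 0))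
    where open ShortestOddCycle C

  triangle : ShortestOddCycle G 3 → InducedSub K3 G
  triangle C = induced-embedding G K3 (vertex ∘ toℕ) table (λ twins → ⊥-elim (twinFree-K3 _ _ twins))
    where
    open ShortestOddCycle C
    closing : Adj G (vertex 2) (vertex 0)
    closing = subst (Adj G (vertex 2)) (periodic 0) (adjacent 2)
    table : AgreeAbove (λ u v → adj G (vertex (toℕ u)) (vertex (toℕ v))) (adj K3)
    table = (T⇒≡true (adjacent 0) ∷ T⇒≡true (Adj-sym G closing) ∷ [])
          , (T⇒≡true (adjacent 1) ∷ [])
          , [] , tt

  pentagon : ShortestOddCycle G 5 → InducedSub C5 G
  pentagon C = induced-embedding G C5 (vertex ∘ toℕ) table (λ twins → ⊥-elim (twinFree-C5 _ _ twins))
    where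
    open ShortestOddCycle C
    open ShortestOddCycleFacts C
    closing : Adj G (vertex 4) (vertex 0)
    closing = subst (Adj G (vertex 4)) (periodic 0) (adjacent 4)
    table : AgreeAbove (λ u v → adj G (vertex (toℕ u)) (vertex (toℕ v))) (adj C5)
    table = ( T⇒≡true (adjacent 0) ∷ ¬T⇒≡false (non-chord 0 2) ∷ ¬T⇒≡false (non-chord 0 3) ∷
              T⇒≡true (Adj-sym G closing) ∷ [])
          , (T⇒≡true (adjacent 1) ∷ ¬T⇒≡false (non-chord 1 2) ∷ ¬T⇒≡false (non-chord 1 3) ∷ [])
          , (T⇒≡true (adjacent 2) ∷ ¬T⇒≡false (non-chord 2 2) ∷ [])
          , (T⇒≡true (adjacent 3) ∷ [])
          , [] , tt

-- Long shortest odd cycles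

module OddCycleColouring (m : ℕ) (m-even : parity m ≡ 0ℙ) where

  side-vertex : Parity → Fin 5
  side-vertex 0ℙ = # 0
  side-vertex 1ℙ = # 1

  pentagon-vertex : ℕ → Fin 5
  pentagon-vertex 0 = # 0
  pentagon-vertex 1 = # 1
  pentagon-vertex 2 = # 2
  pentagon-vertex 3 = # 3
  pentagon-vertex _ = # 4

  colour : ℕ → Fin 5
  colour q with q <? m
  ... | yes _ = side-vertex (parity q)
  ... | no _  = pentagon-vertex (q ∸ m)

  side-vertex-adjacent : ∀ p → Adj C5 (side-vertex p) (side-vertex (p ⁻¹))
  side-vertex-adjacent 0ℙ = tt
  side-vertex-adjacent 1ℙ = tt

  pentagon-vertex-adjacent : ∀ j → j < 4 → Adj C5 (pentagon-vertex j) (pentagon-vertex (suc j))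
  pentagon-vertex-adjacent 0 _ = tt
  pentagon-vertex-adjacent 1 _ = tt
  pentagon-vertex-adjacent 2 _ = tt
  pentagon-vertex-adjacent 3 _ = tt
  pentagon-vertex-adjacent (suc (suc (suc (suc _)))) (s≤s (s≤s (s≤s (s≤s ()))))

  colour-step : ∀ q → suc q < 5 + m → Adj C5 (colour q) (colour (suc q))
  colour-step q q+1<L with q <? m | suc q <? m
  ... | yes _   | yes _     =
    subst (λ p → Adj C5 (side-vertex (parity q)) (side-vertex p)) (≡-sym (parity-suc q))
          (side-vertex-adjacent (parity q))
  ... | yes q<m | no q+1≮m  =
    subst₂ (λ p j → Adj C5 (side-vertex p) (pentagon-vertex j)) q-odd (≡-sym (m≤n⇒m∸n≡0 q<m)) tt
    where
    q-odd : 1ℙ ≡ parity q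
    q-odd = ⁻¹-selfInverse (trans (≡-sym (parity-suc q))
                                  (trans (cong parity (≤-antisym q<m (≮⇒≥ q+1≮m))) m-even))
  ... | no q≮m  | yes q+1<m = contradiction (<⇒≤ q+1<m) q≮m
  ... | no q≮m  | no _      =
    subst (λ j → Adj C5 (pentagon-vertex (q ∸ m)) (pentagon-vertex j)) (≡-sym (+-∸-assoc 1 (≮⇒≥ q≮m)))
          (pentagon-vertex-adjacent (q ∸ m) (m<n+o⇒m∸n<o q m (subst (q <_) (+-comm 4 m) (≤-pred q+1<L))))

  colour-last : colour (4 + m) ≡ # 4
  colour-last with (4 + m) <? m
  ... | yes 4+m<m = contradiction 4+m<m (m+n≮n 4 m)
  ... | no _      = cong pentagon-vertex (m+n∸n≡m 4 m)

  colour-first : colour 0 ≡ # 0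
  colour-first with 0 <? m
  ... | yes _ = refl
  ... | no _  = cong pentagon-vertex (0∸n≡0 m)

  colour-wrap : Adj C5 (colour 0) (colour (4 + m))
  colour-wrap = subst₂ (Adj C5) (≡-sym colour-first) (≡-sym colour-last) tt

module LongOddCycle {G : Graph n} (spider-free : Free (S 2 2 1) G ⊎ Free (S 3 1 1) G)
                    (t : ℕ) (C : ShortestOddCycle G (7 + t)) where

  open ShortestOddCycle C renaming (vertex to c)
  open ShortestOddCycleFacts C

  L : ℕ
  L = 7 + t

  t-even : parity t ≡ 0ℙ
  t-even = ≡-sym (⁻¹-selfInverse (trans (≡-sym (parity-suc t)) odd))

  open OddCycleColouring (2 + t) t-even

  periodic-+ : ∀ k m → c (k + (L + m)) ≡ c (k + m)
  periodic-+ k m = trans (cong c (x∙yz≈y∙xz k L m)) (periodic (k + m))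

  periodic-* : ∀ m j → c (m + j * L) ≡ c m
  periodic-* m zero    = cong c (+-identityʳ m)
  periodic-* m (suc j) = trans (periodic-+ m (j * L)) (periodic-* m j)

  periodic-% : ∀ k m → c (k + m % L) ≡ c (k + m)
  periodic-% k m = ≡-sym (begin
    c (k + m)                     ≡⟨ cong (λ i → c (k + i)) (m≡m%n+[m/n]*n m L) ⟩
    c (k + (m % L + m / L * L))   ≡⟨ cong c (≡-sym (+-assoc k (m % L) _)) ⟩
    c (k + m % L + m / L * L)     ≡⟨ periodic-* (k + m % L) (m / L) ⟩
    c (k + m % L)                 ∎)
    where open ≡-Reasoning

  -- z, the cycle path c b … c (5 + b) and the pendant y span S₂,₂,₁ (legs z c₃ c₄, z c₁ c₀, z y)
  -- and S₃,₁,₁ (legs z c₃ c₄ c₅, z c₁, z y), writing cᵢ for c (i + b).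
  no-spider : ∀ b {z y} → Adj G z (c (1 + b)) → Adj G z (c (3 + b)) → Adj G z y →
              ¬ Adj G y (c b) → ¬ Adj G y (c (1 + b)) → ¬ Adj G y (c (3 + b)) →
              ¬ Adj G y (c (4 + b)) → ¬ Adj G y (c (5 + b)) → ⊥
  no-spider b {z} {y} z₁ z₃ zy y₀ y₁ y₃ y₄ y₅ =
    [ (λ free → free S221-embedding) , (λ free → free S311-embedding) ] spider-free
    where
    z₀ : ¬ Adj G z (c b)
    z₀ a = non-common b 1 a z₁
    z₄ : ¬ Adj G z (c (4 + b))
    z₄ = non-common (3 + b) 1 z₃
    z₅ : ¬ Adj G z (c (5 + b))
    z₅ = non-common (1 + b) 4 z₁

    edge : ∀ {u v} → Adj G u v → adj G u v ≡ true
    edge = T⇒≡true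
    non-edge : ∀ {u v} → ¬ Adj G u v → adj G u v ≡ false
    non-edge = ¬T⇒≡false
    non-edge˘ : ∀ {u v} → ¬ Adj G u v → adj G v u ≡ false
    non-edge˘ ¬uv = ¬T⇒≡false (¬uv ∘ Adj-sym G)

    f₁ : Fin 6 → Fin n
    f₁ = lookup (z ∷ c (3 + b) ∷ c (4 + b) ∷ c (1 + b) ∷ c b ∷ y ∷ [])
    table₁ : AgreeAbove (λ u v → adj G (f₁ u) (f₁ v)) (adj (S 2 2 1))
    table₁ = (edge z₃ ∷ non-edge z₄ ∷ edge z₁ ∷ non-edge z₀ ∷ edge zy ∷ [])
           , (edge (adjacent (3 + b)) ∷ non-edge˘ (non-chord (1 + b) 2) ∷ non-edge˘ (non-chord b 3) ∷
              non-edge˘ y₃ ∷ [])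
           , (non-edge˘ (non-chord (1 + b) 3) ∷ non-edge˘ (non-chord b 4) ∷ non-edge˘ y₄ ∷ [])
           , (edge (Adj-sym G (adjacent b)) ∷ non-edge˘ y₁ ∷ [])
           , (non-edge˘ y₀ ∷ [])
           , [] , tt
    S221-embedding : InducedSub (S 2 2 1) G
    S221-embedding =
      induced-embedding G (S 2 2 1) f₁ table₁ λ twins → ⊥-elim (twinFree-S221 _ _ twins)

    f₂ : Fin 6 → Fin n
    f₂ = lookup (z ∷ c (3 + b) ∷ c (4 + b) ∷ c (5 + b) ∷ c (1 + b) ∷ y ∷ [])
    table₂ : AgreeAbove (λ u v → adj G (f₂ u) (f₂ v)) (adj (S 3 1 1))
    table₂ = (edge z₃ ∷ non-edge z₄ ∷ non-edge z₅ ∷ edge z₁ ∷ edge zy ∷ [])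
           , (edge (adjacent (3 + b)) ∷ non-edge (non-chord (3 + b) 2) ∷ non-edge˘ (non-chord (1 + b) 2) ∷
              non-edge˘ y₃ ∷ [])
           , (edge (adjacent (4 + b)) ∷ non-edge˘ (non-chord (1 + b) 3) ∷ non-edge˘ y₄ ∷ [])
           , (non-edge˘ (non-chord (1 + b) 4) ∷ non-edge˘ y₅ ∷ [])
           , (non-edge˘ y₁ ∷ [])
           , [] , tt
    separated : ∀ {u v} → Twins (S 3 1 1) u v → f₂ u ≢ f₂ v
    separated {u} {v} twins with twins-S311 u v twins
    ... | inj₁ refl = λ c₁≡y → y₀ (subst (λ x → Adj G x (c b)) c₁≡y (Adj-sym G (adjacent b)))
    ... | inj₂ refl = λ y≡c₁ → y₀ (subst (λ x → Adj G x (c b)) (≡-sym y≡c₁) (Adj-sym G (adjacent b)))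
    S311-embedding : InducedSub (S 3 1 1) G
    S311-embedding = induced-embedding G (S 3 1 1) f₂ table₂ separated

  -- w sees both cycle-neighbours of c (1 + q); it will be coloured like position q.
  Clone : Fin n → ℕ → Set
  Clone w q = Adj G w (c q) × Adj G w (c (2 + q))

  clone? : ∀ w q → Dec (Clone w q)
  clone? w q = T? (adj G w (c q)) ×-dec T? (adj G w (c (2 + q)))

  clone-of-neighbour : ∀ {w m} → Adj G w (c m) → ∃ (Clone w)
  clone-of-neighbour {w} {m} a with T? (adj G w (c (2 + m))) | T? (adj G w (c (5 + t + m)))
  ... | yes a₂ | _      = m , a , a₂
  ... | no _   | yes a₋ = 5 + t + m , a₋ , subst (Adj G w) (≡-sym (periodic m)) a
  ... | no ¬a₂ | no ¬a₋ = ⊥-elim (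
    no-spider b (Adj-sym G (adjacent (1 + b))) (adjacent (2 + b)) (Adj-sym G a′)
              ¬a₋ (λ a₁ → non-common (1 + b) 1 a₁ a′) (non-common (2 + b) 1 a′)
              (¬a₂ ∘ subst (Adj G w) (periodic-+ 2 m)) (non-common (2 + b) 3 a′))
    where
    b : ℕ
    b = 5 + t + m
    a′ : Adj G w (c (2 + b))
    a′ = subst (Adj G w) (≡-sym (periodic m)) a

  clone-neighbour-sees-cycle : ∀ {v w q} → Clone v q → Adj G v w → ¬ (∀ m → ¬ Adj G w (c m))
  clone-neighbour-sees-cycle {q = q} (a₀ , a₂) vw blind =
    no-spider (6 + t + q) (subst (Adj G _) (≡-sym (periodic q)) a₀)
              (subst (Adj G _) (≡-sym (periodic-+ 2 q)) a₂) vw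
              (blind _) (blind _) (blind _) (blind _) (blind _)

  clones-three-apart : ∀ {v w x} → Clone v x → Clone w (3 + x) → ¬ Adj G v w
  clones-three-apart {x = x} (v₀ , _) (_ , w₂) vw
    with detour x 5 (m≤m+n 6 (suc t)) (Adj-sym G v₀ ∷ vw ∷ w₂ ∷ [])
  ... | inj₁ (_ , s≤s (s≤s (s≤s ())))
  ... | inj₂ (() , _)

  -- Given d < L ≤ 3 + d: d = L − 3 is the previous lemma read backwards around the cycle,
  -- d = L − 2 has the wrong parity, and only d = L − 1 (forcing q = 0) remains.
  far-clones : ∀ {v w} q d → d + q < L → Clone v q → Clone w (d + q) → Adj G v w →
               parity (d + 3) ≡ 1ℙ → L ≤ 3 + d → suc d ≡ L × q ≡ 0
  far-clones {v} q d d+q<L cv cw vw odd-d+3 L≤3+d with m≤n⇒m<n∨m≡n L≤3+d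
  ... | inj₂ L≡3+d = ⊥-elim (clones-three-apart cw cv′ (Adj-sym G vw))
    where
    cv′ : Clone v (3 + (d + q))
    cv′ = subst (Adj G v) (≡-sym (trans (cong (λ i → c (i + q)) (≡-sym L≡3+d)) (periodic q))) (proj₁ cv)
        , subst (Adj G v) (≡-sym (trans (cong (λ i → c (2 + (i + q))) (≡-sym L≡3+d)) (periodic-+ 2 q)))
                (proj₂ cv)
  ... | inj₁ L<3+d with m≤n⇒m<n∨m≡n L<3+d
  ...   | inj₂ 1+L≡3+d = contradiction (trans (≡-sym even) odd′) λ ()
    where
    even : parity (suc L) ≡ 0ℙ
    even = trans (parity-suc L) (cong _⁻¹ odd)
    odd′ : parity (suc L) ≡ 1ℙ
    odd′ = trans (cong parity 1+L≡3+d) (trans (cong parity (+-comm 3 d)) odd-d+3)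
  ...   | inj₁ (s≤s (s≤s L≤1+d)) = ≤-antisym d<L L≤1+d , n≤0⇒n≡0 (+-cancelˡ-≤ d q 0 d+q≤d+0)
    where
    d<L : d < L
    d<L = ≤-trans (s≤s (m≤m+n d q)) d+q<L
    d+q≤d+0 : d + q ≤ d + 0
    d+q≤d+0 = subst (d + q ≤_) (≡-sym (+-identityʳ d)) (≤-pred (≤-trans d+q<L L≤1+d))

  adjacent-clones : ∀ {v w} q d → d + q < L → Clone v q → Clone w (d + q) → Adj G v w →
                    d ≡ 1 ⊎ (suc d ≡ L × q ≡ 0)
  adjacent-clones q d d+q<L cv cw vw
    with detour q d (≤-trans (s≤s (m≤m+n d q)) d+q<L) (Adj-sym G (proj₁ cv) ∷ vw ∷ proj₁ cw ∷ [])
  ... | inj₁ (() , z≤n)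
  ... | inj₁ (_ , s≤s z≤n)             = inj₁ refl
  ... | inj₁ (() , s≤s (s≤s z≤n))
  ... | inj₁ (_ , s≤s (s≤s (s≤s z≤n))) = ⊥-elim (clones-three-apart cv cw vw)
  ... | inj₂ (odd-d+3 , L≤d+3)         =
    inj₂ (far-clones q d d+q<L cv cw vw odd-d+3 (subst (L ≤_) (+-comm d 3) L≤d+3))

  ordered-clone-colours : ∀ {v w q q′} → q ≤ q′ → q′ < L → Clone v q → Clone w q′ → Adj G v w →
                          Adj C5 (colour q) (colour q′)
  ordered-clone-colours {q = q} q≤q′ q′<L cv cw vw with m≤n⇒∃[o]o+m≡n q≤q′
  ... | d , refl with adjacent-clones q d q′<L cv cw vw
  ...   | inj₁ refl              = colour-step q q′<L
  ...   | inj₂ (1+d≡L , refl)    =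
    subst (λ j → Adj C5 (colour 0) (colour j)) (≡-sym (trans (+-identityʳ d) (suc-injective 1+d≡L)))
          colour-wrap

  clone-colours-adjacent : ∀ {v w q q′} → q < L → q′ < L → Clone v q → Clone w q′ → Adj G v w →
                           Adj C5 (colour q) (colour q′)
  clone-colours-adjacent {q = q} {q′} q<L q′<L cv cw vw with q ≤? q′
  ... | yes q≤q′ = ordered-clone-colours q≤q′ q′<L cv cw vw
  ... | no q≰q′  =
    Adj-sym C5 {colour q′} {colour q} (ordered-clone-colours (≰⇒≥ q≰q′) q<L cw cv (Adj-sym G vw))

  SeesCycle : Fin n → Set
  SeesCycle w = ∃ λ (i : Fin L) → Adj G w (c (toℕ i))

  sees-cycle? : ∀ w → Dec (SeesCycle w)
  sees-cycle? w = any? λ i → T? (adj G w (c (toℕ i)))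

  X : Subset n
  X = subset sees-cycle?

  sees-cycle : ∀ {w m} → Adj G w (c m) → w ∈ X
  sees-cycle {w} {m} a = ∈-subset⁺ sees-cycle? (i , subst (Adj G w) (≡-sym c-i≡c-m) a)
    where
    i : Fin L
    i = fromℕ< (m%n<n m L)
    c-i≡c-m : c (toℕ i) ≡ c m
    c-i≡c-m = trans (cong c (toℕ-fromℕ< (m%n<n m L))) (periodic-% 0 m)

  Clone-% : ∀ {w q} → Clone w q → Clone w (q % L)
  Clone-% {w} {q} (a₀ , a₂) =
    subst (Adj G w) (≡-sym (periodic-% 0 q)) a₀ , subst (Adj G w) (≡-sym (periodic-% 2 q)) a₂

  clone-in-range : ∀ {w} → w ∈ X → ∃ λ q → q < L × Clone w q
  clone-in-range w∈X with ∈-subset⁻ sees-cycle? w∈X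
  ... | _ , a with clone-of-neighbour a
  ...   | q , clone = q % L , m%n<n q L , Clone-% clone

  X-closed : Closed G X
  X-closed {u} {v} u∈X uv with v ∈? X
  ... | yes v∈X = v∈X
  ... | no v∉X with clone-in-range u∈X
  ...   | _ , _ , cl = ⊥-elim (clone-neighbour-sees-cycle cl uv λ m a → v∉X (sees-cycle a))

  paint : Fin n → Fin 5
  paint w with any? (λ (q : Fin L) → clone? w (toℕ q))
  ... | yes (q , _) = colour (toℕ q)
  ... | no _        = # 0

  paint-clone : ∀ {w} → w ∈ X → ∃ λ q → q < L × Clone w q × paint w ≡ colour q
  paint-clone {w} w∈X with any? (λ (q : Fin L) → clone? w (toℕ q))
  ... | yes (q , cl) = toℕ q , toℕ<n q , cl , refl
  ... | no none with clone-in-range w∈X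
  ...   | q , q<L , cl = ⊥-elim (none (fromℕ< q<L , subst (Clone w) (≡-sym (toℕ-fromℕ< q<L)) cl))

  paint-hom : ∀ {u v} → u ∈ X → Adj G u v → Adj C5 (paint u) (paint v)
  paint-hom u∈X uv with paint-clone u∈X | paint-clone (X-closed u∈X uv)
  ... | q , q<L , cu , pu | q′ , q′<L , cv , pv =
    subst₂ (Adj C5) (≡-sym pu) (≡-sym pv) (clone-colours-adjacent q<L q′<L cu cv uv)

  part : ∀ r → ColouredPart G C5 r
  part r = record
    { X          = X
    ; anchored   = inj₂ (c 1 , c 2 , sees-cycle (Adj-sym G (adjacent 0)) , adjacent 1)
    ; closed     = X-closed
    ; colour     = paint
    ; colour-hom = paint-hom
    }

coloured-part : {G : Graph n} → Free (S 2 2 1) G ⊎ Free (S 3 1 1) G → Free C5 G → Free K3 G →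
                ∀ r → ColouredPart G C5 r
coloured-part spider-free C5-free K3-free r with bipartite-part-or-odd C5 {# 0} {# 1} tt r
... | inj₁ bipartite = bipartite
... | inj₂ odd-walk with shortest-odd-cycle odd-walk
...   | 0 , C = contradiction (ShortestOddCycle.odd C) λ ()
...   | 1 , C = ⊥-elim (loop-free C)
...   | 2 , C = contradiction (ShortestOddCycle.odd C) λ ()
...   | 3 , C = ⊥-elim (K3-free (triangle C))
...   | 4 , C = contradiction (ShortestOddCycle.odd C) λ ()
...   | 5 , C = ⊥-elim (C5-free (pentagon C))
...   | 6 , C = contradiction (ShortestOddCycle.odd C) λ ()
...   | suc (suc (suc (suc (suc (suc (suc t)))))) , C = LongOddCycle.part spider-free t C r

lemma3 : (n : ℕ) (G : Graph n) →
    (Free (S 2 2 1) G ⊎ Free (S 3 1 1) G) →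
    Free C5 G → Free K3 G → C5Colorable G
lemma3 n G spider-free C5-free K3-free =
  homomorphism-from-parts G C5 (# 0) λ U r _ →
    coloured-part
      (Sum.map (Free-[] G U (S 2 2 1) noIsolated-S221) (Free-[] G U (S 3 1 1) noIsolated-S311) spider-free)
      (Free-[] G U C5 noIsolated-C5 C5-free)
      (Free-[] G U K3 noIsolated-K3 K3-free)
      r
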